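{- Let $H$ be a finite hypergraph, let $f$ be a rotation of order $n$ in $H$ with $0$-th component $U_0$, and let $M_H$ be an $f$-compatible matrix. Then for every $n$-th root of unity $\omega\neq 1$, every eigenvalue of the $\omega$-rotation matrix $M^{\omega}_H(f,U_0)$ is an eigenvalue of $M_H$.
   Context: A hypergraph $H$ is a pair $(V(H),E(H))$ with $V(H)$ a nonempty finite set and $E(H)$ a set of nonempty subsets of $V(H)$. An automorphism of $H$ is a bijection $f:V(H)\to V(H)$ such that for every subset $e\subseteq V(H)$, $e\in E(H)$ if and only if $\{f(v):v\in e\}\in E(H)$. For an integer $n\ge 2$, a rotation of order $n$ in $H$ is an automorphism $f$ of $H$ with $f^n=\mathrm{id}$ such that $V(H)$ is partitioned into pairwise disjoint sets $V(H)=U_0\cup U_1\cup\cdots\cup U_{n-1}\cup X$ with $f(v)=v$ for all $v\in X$, $U_{i+1}=\{f(v):v\in U_i\}$ for $i=0,\ldots,n-2$, and $U_0=\{f(v):v\in U_{n-1}\}$; $U_i$ is the $i$-th component and $X$ the invariant set. A complex square matrix $M_H=(m_{uv})_{u,v\in V(H)}$ is $f$-compatible if $m_{uv}=m_{f(u)f(v)}$ for all $u,v$. For an $n$-th root of unity $\omega$, the $\omega$-rotation matrix is $M^{\omega}_H(f,U_0)=(r_{uv})_{u,v\in U_0}$ with $r_{uv}=\sum_{i=0}^{n-1}\omega^i m_{u f^i(v)}$. -}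

module Defs where

open import Level using (Level; _⊔_) renaming (suc to lsuc)
open import Data.Nat.Base as ℕ using (ℕ; zero; suc; _≤_; s≤s)
open import Data.Nat.Properties using (_<?_)
open import Data.Fin.Base using (Fin; zero; suc; toℕ; fromℕ<)
open import Data.Fin.Properties using (_≟_; any?)
open import Data.Fin.Subset using (Subset; _∈_; Nonempty)
open import Data.Fin.Subset.Properties using (_∈?_)
open import Data.Vec.Base using (tabulate)
open import Data.Maybe.Base using (Maybe; just; nothing)
open import Data.Bool.Base using (Bool; true; false; if_then_else_)
open import Data.Product using (Σ; ∃; _×_; _,_)
open import Relation.Nullary using (¬_; yes; no)
open import Relation.Nullary.Decidable using (⌊_⌋; _×-dec_)
open import Relation.Binary.PropositionalEquality using (_≡_)
open import Function.Base using (const)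
open import Function.Bundles using (_⇔_)
open import Function.Definitions using (Bijective)
open import Algebra.Bundles using (CommutativeRing; Semiring)
import Algebra.Definitions.RawSemiring as RS

record Field (c ℓ : Level) : Set (lsuc (c ⊔ ℓ)) where
  field
    commutativeRing : CommutativeRing c ℓ
  open CommutativeRing commutativeRing public
  field
    1≉0     : ¬ (1# ≈ 0#)
    inverse : ∀ x → ¬ (x ≈ 0#) → ∃ λ y → x * y ≈ 1#
  open RS (Semiring.rawSemiring semiring) public using (sum; _^_) renaming (_×_ to _·ℕ_)

module _ {c ℓ} (K : Field c ℓ) where
  open Field K

  CharZero : Set ℓ
  CharZero = ∀ (k : ℕ) → ¬ ((suc k ·ℕ 1#) ≈ 0#)

  AlgClosed : Set (c ⊔ ℓ)
  AlgClosed = ∀ (d : ℕ) (cs : Fin (suc d) → Carrier) →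
    ∃ λ z → ((z ^ suc d) + sum (λ i → cs i * (z ^ toℕ i))) ≈ 0#

record Hypergraph : Set₁ where
  field
    N          : ℕ
    nonemptyV  : 1 ≤ N
    IsEdge     : Subset N → Set
    edgeNonempty : ∀ e → IsEdge e → Nonempty e

image : ∀ {N} → (Fin N → Fin N) → Subset N → Subset N
image f e = tabulate λ w → ⌊ any? (λ v → (v ∈? e) ×-dec (f v ≟ w)) ⌋

iter : ∀ {A : Set} → ℕ → (A → A) → A → A
iter zero    f x = x
iter (suc i) f x = f (iter i f x)

module _ (H : Hypergraph) where
  open Hypergraph H

  IsAutomorphism : (Fin N → Fin N) → Set
  IsAutomorphism f =
    Bijective _≡_ _≡_ f × (∀ (e : Subset N) → IsEdge e ⇔ IsEdge (image f e))

next : ∀ {n} → Fin n → Fin n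
next {suc m} i with suc (toℕ i) <? suc m
... | yes p = fromℕ< p
... | no  _ = zero

-- Rotations of order n.  The partition V = U_0 ∪ ... ∪ U_{n-1} ∪ X is
-- given by  comp : V → Maybe (Fin n):  comp v ≡ just i  iff  v ∈ U_i,
-- comp v ≡ nothing  iff  v ∈ X.

module _ (H : Hypergraph) where
  open Hypergraph H

  record IsRotation (n : ℕ) (f : Fin N → Fin N) : Set₁ where
    field
      order≥2     : 2 ≤ n
      automorphism : IsAutomorphism H f
      f^n≡id      : ∀ v → iter n f v ≡ v
      comp        : Fin N → Maybe (Fin n)
      fixX        : ∀ v → comp v ≡ nothing → f v ≡ v
      mapsTo      : ∀ v i → comp v ≡ just i → comp (f v) ≡ just (next i)
      onto        : ∀ w i → comp w ≡ just (next i) →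
                    ∃ λ v → comp v ≡ just i × f v ≡ w

  isZeroComp : ∀ {n} → Maybe (Fin n) → Bool
  isZeroComp (just zero) = true
  isZeroComp _           = false

module _ {c ℓ} (K : Field c ℓ) where
  open Field K

  -- The eigenvector is a vector indexed by S (extended by 0 outside S).
  IsEigenvalueOn : ∀ {N} → (Fin N → Bool) → (Fin N → Fin N → Carrier) →
                   Carrier → Set (c ⊔ ℓ)
  IsEigenvalueOn {N} inS A λ′ = Σ (Fin N → Carrier) λ x →
      (∀ v → inS v ≡ false → x v ≈ 0#)
    × (∃ λ v → inS v ≡ true × ¬ (x v ≈ 0#))
    × (∀ u → inS u ≡ true →
         sum (λ v → if inS v then A u v * x v else 0#) ≈ λ′ * x u)

  IsEigenvalue : ∀ {N} → (Fin N → Fin N → Carrier) → Carrier → Set (c ⊔ ℓ)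
  IsEigenvalue A λ′ = IsEigenvalueOn (const true) A λ′

  IsCompatible : ∀ {N} → (Fin N → Fin N) → (Fin N → Fin N → Carrier) → Set ℓ
  IsCompatible f M = ∀ u v → M u v ≈ M (f u) (f v)

  -- entries r_{uv} = Σ_{i<n} ω^i m_{u f^i(v)}  of the ω-rotation matrix
  -- (only the entries with u, v ∈ U_0 are used)
  rotationMatrix : ∀ {N} (n : ℕ) → (Fin N → Fin N) →
                   (Fin N → Fin N → Carrier) → Carrier →
                   Fin N → Fin N → Carrier
  rotationMatrix n f M ω u v = sum (λ (i : Fin n) → (ω ^ toℕ i) * M u (iter (toℕ i) f v))

{-# OPTIONS --safe #-}
-- An eigenvector x of the ω-rotation matrix R is supported on U₀; lift it to
-- y(w) = Σᵢ ωⁱ x(f⁻ⁱ w).  Reindexing the double sum gives M y = R x, and y = x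
-- on U₀ because f⁻ⁱ moves U₀ off U₀ for 0 < i < n.  Compatibility of M makes
-- both R x and y ω-equivariant (F ∘ f = ω F), and an ω-equivariant function is
-- determined by its restriction to U₀: on Uⱼ = fʲ(U₀) it is ωʲ times that
-- restriction, and on the invariant set it vanishes because ω ≠ 1.  As
-- R x = λ x = λ y on U₀, it follows that M y = R x = λ y everywhere.
module Submission where

open import Defs
open import Level using (Level)
open import Data.Nat.Base as ℕ using (ℕ; zero; suc; _∸_; _<_; _≤_; s≤s; NonZero)
open import Data.Nat.Properties as ℕ
  using (_<?_; ≤-antisym; ≮⇒≥; <⇒≤; m∸n+n≡m; m+[n∸m]≡n; 0≢1+n)
open import Data.Nat.DivMod using (_%_; %-distribˡ-+; m%n%n≡m%n; m<n⇒m%n≡m; n%n≡0)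
open import Data.Fin.Base using (Fin; zero; suc; toℕ; inject₁; fromℕ)
open import Data.Fin.Properties using (toℕ<n; toℕ-fromℕ<; toℕ-inject₁; toℕ-fromℕ; toℕ-injective)
open import Data.Fin.Permutation using (permutation)
open import Data.Maybe.Base using (Maybe; just; nothing)
open import Data.Maybe.Properties using (just-injective)
open import Data.Bool.Base using (Bool; true; false; if_then_else_)
open import Data.Product using (_,_)
open import Data.Empty using (⊥-elim)
open import Relation.Nullary using (¬_; yes; no)
open import Relation.Binary.PropositionalEquality as ≡ using (_≡_; cong)
open import Function.Base using (_∘_)
open import Algebra.Bundles using (Semiring)

iter-suc : ∀ {A : Set} i (h : A → A) x → iter (suc i) h x ≡ iter i h (h x)
iter-suc zero    h x = ≡.refl
iter-suc (suc i) h x = cong h (iter-suc i h x)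

iter-+ : ∀ {A : Set} a b (h : A → A) x → iter a h (iter b h x) ≡ iter (a ℕ.+ b) h x
iter-+ zero    b h x = ≡.refl
iter-+ (suc a) b h x = cong h (iter-+ a b h x)

iter-inverse : ∀ {A : Set} {h g : A → A} → (∀ x → g (h x) ≡ x) →
               ∀ i x → iter i g (iter i h x) ≡ x
iter-inverse g∘h zero    x = ≡.refl
iter-inverse {h = h} {g} g∘h (suc i) x = ≡.trans (iter-suc i g (h (iter i h x)))
  (≡.trans (cong (iter i g) (g∘h (iter i h x))) (iter-inverse g∘h i x))

iter-∸ : ∀ {A : Set} {n k} {h : A → A} → (∀ x → iter n h x ≡ x) → k ≤ n →
         ∀ x → iter k h (iter (n ∸ k) h x) ≡ x
iter-∸ {n = n} {k} {h} hⁿ≡id k≤n x = ≡.trans (iter-+ k (n ∸ k) h x)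
  (≡.trans (cong (λ j → iter j h x) (m+[n∸m]≡n k≤n)) (hⁿ≡id x))

[1+m%n]%n≡[1+m]%n : ∀ m n .{{_ : NonZero n}} → suc (m % n) % n ≡ suc m % n
[1+m%n]%n≡[1+m]%n m n = begin
  suc (m % n) % n                 ≡⟨ %-distribˡ-+ 1 (m % n) n ⟩
  (1 % n ℕ.+ m % n % n) % n       ≡⟨ cong (λ z → (1 % n ℕ.+ z) % n) (m%n%n≡m%n m n) ⟩
  (1 % n ℕ.+ m % n) % n           ≡⟨ %-distribˡ-+ 1 m n ⟨
  suc m % n                       ∎
  where open ≡.≡-Reasoning

toℕ-next : ∀ {m} (i : Fin (suc m)) → toℕ (next i) ≡ suc (toℕ i) % suc m
toℕ-next {m} i with suc (toℕ i) <? suc m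
... | yes i+1<n = ≡.trans (toℕ-fromℕ< i+1<n) (≡.sym (m<n⇒m%n≡m i+1<n))
... | no  i+1≮n = ≡.trans (≡.sym (n%n≡0 (suc m))) (cong (_% suc m) (≡.sym i+1≡n))
  where
  i+1≡n : suc (toℕ i) ≡ suc m
  i+1≡n = ≤-antisym (toℕ<n i) (≮⇒≥ i+1≮n)

toℕ-iter-next : ∀ {m} k (i : Fin (suc m)) → toℕ (iter k next i) ≡ (k ℕ.+ toℕ i) % suc m
toℕ-iter-next     zero    i = ≡.sym (m<n⇒m%n≡m (toℕ<n i))
toℕ-iter-next {m} (suc k) i = ≡.trans (toℕ-next (iter k next i))
  (≡.trans (cong (λ z → suc z % suc m) (toℕ-iter-next k i)) ([1+m%n]%n≡[1+m]%n (k ℕ.+ toℕ i) (suc m)))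

toℕ-iter-next-zero : ∀ {m k} → k < suc m → toℕ (iter k next (zero {m})) ≡ k
toℕ-iter-next-zero {m} {k} k<n = ≡.trans (toℕ-iter-next k zero)
  (≡.trans (cong (_% suc m) (ℕ.+-identityʳ k)) (m<n⇒m%n≡m k<n))

iter-next-complement : ∀ {m} (i : Fin (suc m)) → iter (suc m ∸ toℕ i) next i ≡ zero
iter-next-complement {m} i = toℕ-injective (≡.trans (toℕ-iter-next (suc m ∸ toℕ i) i)
  (≡.trans (cong (_% suc m) (m∸n+n≡m (<⇒≤ (toℕ<n i)))) (n%n≡0 (suc m))))

module SemiringSums {c ℓ} (S : Semiring c ℓ) where
  open Semiring S
  open import Algebra.Definitions.RawSemiring rawSemiring using (sum; _^_)
  open import Algebra.Properties.Semiring.Sum S using (sum-cong-≋; sum-init-last; *-distribˡ-sum)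
  open import Relation.Binary.Reasoning.Setoid setoid

  sum-shift : ∀ n (r : ℕ → Carrier) → r n ≈ r 0 →
              sum (λ (i : Fin n) → r (suc (toℕ i))) ≈ sum (λ (i : Fin n) → r (toℕ i))
  sum-shift zero    r _      = refl
  sum-shift (suc m) r rn≈r0 = begin
    sum (λ (i : Fin (suc m)) → r (suc (toℕ i)))
      ≈⟨ sum-init-last (λ (i : Fin (suc m)) → r (suc (toℕ i))) ⟩
    sum (λ (i : Fin m) → r (suc (toℕ (inject₁ i)))) + r (suc (toℕ (fromℕ m)))
      ≈⟨ +-cong (sum-cong-≋ {m} λ i → reflexive (cong (r ∘ suc) (toℕ-inject₁ i)))
                (trans (reflexive (cong (r ∘ suc) (toℕ-fromℕ m))) rn≈r0) ⟩
    sum (λ (i : Fin m) → r (suc (toℕ i))) + r 0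
      ≈⟨ +-comm _ _ ⟩
    r 0 + sum (λ (i : Fin m) → r (suc (toℕ i)))
      ≡⟨⟩
    sum (λ (i : Fin (suc m)) → r (toℕ i)) ∎

  twistedSum : ℕ → Carrier → (ℕ → Carrier) → Carrier
  twistedSum n ω q = sum (λ (i : Fin n) → ω ^ toℕ i * q (toℕ i))

  twistedSum-shift : ∀ n {ω} (q : ℕ → Carrier) → ω ^ n ≈ 1# → q n ≈ q 0 →
                     twistedSum n ω q ≈ ω * twistedSum n ω (q ∘ suc)
  twistedSum-shift n {ω} q ωⁿ≈1 qn≈q0 = begin
    twistedSum n ω q
      ≈⟨ sum-shift n (λ i → ω ^ i * q i) (*-cong ωⁿ≈1 qn≈q0) ⟨
    sum (λ (i : Fin n) → (ω * ω ^ toℕ i) * q (suc (toℕ i)))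
      ≈⟨ sum-cong-≋ {n} (λ i → *-assoc ω (ω ^ toℕ i) (q (suc (toℕ i)))) ⟩
    sum (λ (i : Fin n) → ω * (ω ^ toℕ i * q (suc (toℕ i))))
      ≈⟨ *-distribˡ-sum ω (λ (i : Fin n) → ω ^ toℕ i * q (suc (toℕ i))) ⟨
    ω * twistedSum n ω (q ∘ suc) ∎

  masked-sum : ∀ {N} (inS : Fin N → Bool) (t x : Fin N → Carrier) →
               (∀ v → inS v ≡ false → x v ≈ 0#) →
               sum (λ v → if inS v then t v * x v else 0#) ≈ sum (λ v → t v * x v)
  masked-sum inS t x x-off = sum-cong-≋ masked
    where
    masked : ∀ v → (if inS v then t v * x v else 0#) ≈ t v * x v
    masked v with inS v in e
    ... | true  = refl
    ... | false = sym (trans (*-congˡ (x-off v e)) (zeroʳ (t v)))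

module FieldProperties {c ℓ} (K : Field c ℓ) where
  open Field K
  open import Algebra.Properties.Ring ring using ([y-z]x≈yx-zx; x≈y⇒x∙y⁻¹≈ε; x∙y⁻¹≈ε⇒x≈y)
  open import Relation.Binary.Reasoning.Setoid setoid

  x*y≈0⇒y≈0 : ∀ {x y} → ¬ x ≈ 0# → x * y ≈ 0# → y ≈ 0#
  x*y≈0⇒y≈0 {x} {y} x≉0 xy≈0 with inverse x x≉0
  ... | x⁻¹ , xx⁻¹≈1 = begin
    y              ≈⟨ *-identityˡ y ⟨
    1# * y         ≈⟨ *-congʳ (trans (*-comm x⁻¹ x) xx⁻¹≈1) ⟨
    (x⁻¹ * x) * y  ≈⟨ *-assoc x⁻¹ x y ⟩
    x⁻¹ * (x * y)  ≈⟨ *-congˡ xy≈0 ⟩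
    x⁻¹ * 0#       ≈⟨ zeroʳ x⁻¹ ⟩
    0#             ∎

  x*z≈z⇒z≈0 : ∀ {x z} → ¬ x ≈ 1# → x * z ≈ z → z ≈ 0#
  x*z≈z⇒z≈0 {x} {z} x≉1 xz≈z = x*y≈0⇒y≈0 (x≉1 ∘ x∙y⁻¹≈ε⇒x≈y x 1#) (begin
    (x - 1#) * z    ≈⟨ [y-z]x≈yx-zx z x 1# ⟩
    x * z - 1# * z  ≈⟨ x≈y⇒x∙y⁻¹≈ε (trans xz≈z (sym (*-identityˡ z))) ⟩
    0#              ∎)

module Rotation {c ℓ} (K : Field c ℓ) {H : Hypergraph} {m : ℕ}
                {f : Fin (Hypergraph.N H) → Fin (Hypergraph.N H)}
                (rot : IsRotation H (suc m) f) where
  open Field K hiding (zero)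
  open Hypergraph H using (N)
  open IsRotation rot
  open SemiringSums semiring
  open FieldProperties K
  open import Algebra.Properties.Semiring.Sum semiring
    using (sum-cong-≋; ∑-comm; *-distribˡ-sum; *-distribʳ-sum; sum-permute; sum-replicate-zero)
  open import Algebra.Properties.CommutativeSemigroup *-commutativeSemigroup using (x∙yz≈y∙xz)
  open import Relation.Binary.Reasoning.Setoid setoid

  n : ℕ
  n = suc m

  _·_ : (Fin N → Fin N → Carrier) → (Fin N → Carrier) → Fin N → Carrier
  (A · x) u = sum (λ v → A u v * x v)

  f⁻¹ : Fin N → Fin N
  f⁻¹ = iter m f

  f∘f⁻¹ : ∀ w → f (f⁻¹ w) ≡ w
  f∘f⁻¹ = f^n≡id

  f⁻¹∘f : ∀ w → f⁻¹ (f w) ≡ w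
  f⁻¹∘f w = ≡.trans (≡.sym (iter-suc m f w)) (f^n≡id w)

  sum-reindex : ∀ i (F : Fin N → Fin N → Carrier) →
                sum (λ v → F v (iter i f⁻¹ v)) ≈ sum (λ v → F (iter i f v) v)
  sum-reindex i F = trans
    (sum-permute _ (permutation (iter i f) (iter i f⁻¹) (iter-inverse f∘f⁻¹ i) (iter-inverse f⁻¹∘f i)))
    (sum-cong-≋ λ v → reflexive (cong (F (iter i f v)) (iter-inverse f⁻¹∘f i v)))

  comp-iter : ∀ k {v i} → comp v ≡ just i → comp (iter k f v) ≡ just (iter k next i)
  comp-iter zero    v∈Uᵢ = v∈Uᵢ
  comp-iter (suc k) v∈Uᵢ = mapsTo _ _ (comp-iter k v∈Uᵢ)

  comp-return : ∀ {u j} → comp u ≡ just j → comp (iter (n ∸ toℕ j) f u) ≡ just zero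
  comp-return {j = j} u∈Uⱼ =
    ≡.trans (comp-iter (n ∸ toℕ j) u∈Uⱼ) (cong just (iter-next-complement j))

  inU₀ : Fin N → Bool
  inU₀ v = isZeroComp H (comp v)

  isZeroComp-true : ∀ {c : Maybe (Fin n)} → isZeroComp H c ≡ true → c ≡ just zero
  isZeroComp-true {just zero}    _  = ≡.refl
  isZeroComp-true {just (suc _)} ()
  isZeroComp-true {nothing}      ()

  f⁻¹-leaves-U₀ : ∀ {u k} → comp u ≡ just zero → suc k < n → inU₀ (iter (suc k) f⁻¹ u) ≡ false
  f⁻¹-leaves-U₀ {u} {k} u∈U₀ k+1<n with inU₀ (iter (suc k) f⁻¹ u) in e
  ... | false = ≡.refl
  ... | true  = ⊥-elim (0≢1+n (≡.trans (cong toℕ next^[k+1]0≡0) (toℕ-iter-next-zero k+1<n)))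
    where
    next^[k+1]0≡0 : zero ≡ iter (suc k) next zero
    next^[k+1]0≡0 = just-injective (≡.trans (≡.sym u∈U₀) (≡.trans
      (cong comp (≡.sym (iter-inverse {h = f⁻¹} {g = f} f∘f⁻¹ (suc k) u)))
      (comp-iter (suc k) (isZeroComp-true e))))

  module _ (ω : Carrier) where

    Equivariant : (Fin N → Carrier) → Set ℓ
    Equivariant F = ∀ w → F (f w) ≈ ω * F w

    equivariant-iter : ∀ {F} → Equivariant F → ∀ j w → F (iter j f w) ≈ ω ^ j * F w
    equivariant-iter F-eq zero    w = sym (*-identityˡ _)
    equivariant-iter F-eq (suc j) w = trans (F-eq (iter j f w))
      (trans (*-congˡ (equivariant-iter F-eq j w)) (sym (*-assoc ω (ω ^ j) _)))

    equivariant-scale : ∀ {F} (a : Carrier) → Equivariant F → Equivariant (λ w → a * F w)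
    equivariant-scale {F} a F-eq w = trans (*-congˡ (F-eq w)) (x∙yz≈y∙xz a ω (F w))

    equivariant-fixed : ∀ {F w} → ¬ ω ≈ 1# → Equivariant F → f w ≡ w → F w ≈ 0#
    equivariant-fixed {F} {w} ω≉1 F-eq fw≡w =
      x*z≈z⇒z≈0 ω≉1 (trans (sym (F-eq w)) (reflexive (cong F fw≡w)))

    equivariant-unique : ∀ {F G} → ¬ ω ≈ 1# → Equivariant F → Equivariant G →
                         (∀ u → comp u ≡ just zero → F u ≈ G u) → ∀ u → F u ≈ G u
    equivariant-unique {F} {G} ω≉1 F-eq G-eq F≈G u with comp u in u∈U
    ... | nothing = trans (equivariant-fixed ω≉1 F-eq (fixX u u∈U))
                          (sym (equivariant-fixed ω≉1 G-eq (fixX u u∈U)))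
    ... | just j  = begin
      F u                    ≡⟨ cong F u₀↦u ⟨
      F (iter (toℕ j) f u₀)  ≈⟨ equivariant-iter F-eq (toℕ j) u₀ ⟩
      ω ^ toℕ j * F u₀       ≈⟨ *-congˡ (F≈G u₀ (comp-return u∈U)) ⟩
      ω ^ toℕ j * G u₀       ≈⟨ equivariant-iter G-eq (toℕ j) u₀ ⟨
      G (iter (toℕ j) f u₀)  ≡⟨ cong G u₀↦u ⟩
      G u                    ∎
      where
      u₀ : Fin N
      u₀ = iter (n ∸ toℕ j) f u
      u₀↦u : iter (toℕ j) f u₀ ≡ u
      u₀↦u = iter-∸ f^n≡id (<⇒≤ (toℕ<n j)) u

    twisted-equivariant : ω ^ n ≈ 1# → (Q : Fin N → ℕ → Carrier) →
                          (∀ w i → Q (f w) (suc i) ≈ Q w i) → (∀ w → Q w n ≈ Q w 0) →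
                          Equivariant (λ w → twistedSum n ω (Q w))
    twisted-equivariant ωⁿ≈1 Q Q-shift Q-period w = begin
      twistedSum n ω (Q (f w))            ≈⟨ twistedSum-shift n (Q (f w)) ωⁿ≈1 (Q-period (f w)) ⟩
      ω * twistedSum n ω (Q (f w) ∘ suc)  ≈⟨ *-congˡ (sum-cong-≋ {n} λ i → *-congˡ {ω ^ toℕ i} (Q-shift w (toℕ i))) ⟩
      ω * twistedSum n ω (Q w)            ∎

    rotationMatrix-equivariant : ∀ {M} → IsCompatible K f M → ω ^ n ≈ 1# →
                                 ∀ v → Equivariant (λ u → rotationMatrix K n f M ω u v)
    rotationMatrix-equivariant {M} compat ωⁿ≈1 v = twisted-equivariant ωⁿ≈1
      (λ u i → M u (iter i f v))
      (λ u i → sym (compat u (iter i f v)))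
      (λ u → reflexive (cong (M u) (f^n≡id v)))

    ·-equivariant : ∀ {A} → (∀ v → Equivariant (λ u → A u v)) → ∀ x → Equivariant (A · x)
    ·-equivariant {A} A-eq x u = begin
      sum (λ v → A (f u) v * x v)        ≈⟨ sum-cong-≋ {N} (λ v → trans (*-congʳ (A-eq v u)) (*-assoc ω (A u v) (x v))) ⟩
      sum (λ v → ω * (A u v * x v))      ≈⟨ *-distribˡ-sum ω (λ v → A u v * x v) ⟨
      ω * sum (λ v → A u v * x v)        ∎

    lift : (Fin N → Carrier) → Fin N → Carrier
    lift x w = twistedSum n ω (λ i → x (iter i f⁻¹ w))

    lift-equivariant : ω ^ n ≈ 1# → ∀ x → Equivariant (lift x)
    lift-equivariant ωⁿ≈1 x = twisted-equivariant ωⁿ≈1 (λ w i → x (iter i f⁻¹ w))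
      (λ w i → reflexive (cong x (≡.trans (iter-suc i f⁻¹ (f w)) (cong (iter i f⁻¹) (f⁻¹∘f w)))))
      (λ w → reflexive (cong x (≡.trans (cong (iter n f⁻¹) (≡.sym (f^n≡id w)))
                                        (iter-inverse {h = f} {g = f⁻¹} f⁻¹∘f n w))))

    lift-on-U₀ : ∀ {x u} → (∀ v → inU₀ v ≡ false → x v ≈ 0#) → comp u ≡ just zero →
                 lift x u ≈ x u
    lift-on-U₀ {x} {u} x-off u∈U₀ = begin
      lift x u  ≡⟨⟩
      1# * x u + sum (λ (i : Fin m) → ω ^ suc (toℕ i) * x (iter (suc (toℕ i)) f⁻¹ u))
        ≈⟨ +-cong (*-identityˡ (x u)) (trans (sum-cong-≋ {m} vanishes) (sum-replicate-zero m)) ⟩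
      x u + 0#  ≈⟨ +-identityʳ (x u) ⟩
      x u       ∎
      where
      vanishes : ∀ (i : Fin m) → ω ^ suc (toℕ i) * x (iter (suc (toℕ i)) f⁻¹ u) ≈ 0#
      vanishes i = trans (*-congˡ (x-off _ (f⁻¹-leaves-U₀ u∈U₀ (s≤s (toℕ<n i))))) (zeroʳ _)

    ·-lift : ∀ M x u → (M · lift x) u ≈ (rotationMatrix K n f M ω · x) u
    ·-lift M x u = begin
      sum (λ v → M u v * sum (λ (i : Fin n) → x-term v (toℕ i)))
        ≈⟨ sum-cong-≋ {N} (λ v → trans (*-distribˡ-sum {n} (M u v) (λ i → x-term v (toℕ i)))
             (sum-cong-≋ {n} λ i → x∙yz≈y∙xz (M u v) (ω ^ toℕ i) (x (iter (toℕ i) f⁻¹ v)))) ⟩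
      sum (λ v → sum (λ (i : Fin n) → term v i))
        ≈⟨ ∑-comm term ⟩
      sum (λ (i : Fin n) → sum (λ v → term v i))
        ≈⟨ sum-cong-≋ {n} (λ i → sum-reindex (toℕ i) λ w v → ω ^ toℕ i * (M u w * x v)) ⟩
      sum (λ (i : Fin n) → sum (λ v → term′ v i))
        ≈⟨ ∑-comm term′ ⟨
      sum (λ v → sum (λ (i : Fin n) → term′ v i))
        ≈⟨ sum-cong-≋ {N} (λ v → trans
             (sum-cong-≋ {n} λ i → sym (*-assoc (ω ^ toℕ i) (M u (iter (toℕ i) f v)) (x v)))
             (sym (*-distribʳ-sum {n} (x v) (λ i → R-term v (toℕ i))))) ⟩
      sum (λ v → rotationMatrix K n f M ω u v * x v) ∎
      where
      x-term R-term : Fin N → ℕ → Carrier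
      x-term v i = ω ^ i * x (iter i f⁻¹ v)
      R-term v i = ω ^ i * M u (iter i f v)
      term term′ : Fin N → Fin n → Carrier
      term  v i = ω ^ toℕ i * (M u v * x (iter (toℕ i) f⁻¹ v))
      term′ v i = ω ^ toℕ i * (M u (iter (toℕ i) f v) * x v)

mainTheorem7 : ∀ {c ℓ : Level} (K : Field c ℓ) → CharZero K → AlgClosed K →
    (H : Hypergraph) (n : ℕ) (f : Fin (Hypergraph.N H) → Fin (Hypergraph.N H)) →
    (rot : IsRotation H n f) →
    (M : Fin (Hypergraph.N H) → Fin (Hypergraph.N H) → Field.Carrier K) →
    IsCompatible K f M →
    (ω : Field.Carrier K) → Field._≈_ K (Field._^_ K ω n) (Field.1# K) →
    ¬ (Field._≈_ K ω (Field.1# K)) →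
    (λ′ : Field.Carrier K) →
    IsEigenvalueOn K (λ v → isZeroComp H (IsRotation.comp rot v))
    (rotationMatrix K n f M ω) λ′ →
    IsEigenvalue K M λ′
mainTheorem7 K _ _ H zero f rot with IsRotation.order≥2 rot
... | ()
mainTheorem7 K _ _ H (suc m) f rot M compat ω ωⁿ≈1 ω≉1 λ′ (x , x-off , (v₀ , v₀∈U₀ , xv₀≉0) , eig) =
  lift ω x , (λ _ ()) , (v₀ , ≡.refl , xv₀≉0 ∘ trans (sym (lift-on-U₀ ω x-off (isZeroComp-true v₀∈U₀))))
  , λ u _ → trans (·-lift ω M x u) (R·x≈λ′y u)
  where
  open Field K hiding (zero)
  open Rotation K rot
  open SemiringSums semiring using (masked-sum)
  R : Fin (Hypergraph.N H) → Fin (Hypergraph.N H) → Carrier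
  R = rotationMatrix K (suc m) f M ω
  R·x≈λ′y : ∀ u → (R · x) u ≈ λ′ * lift ω x u
  R·x≈λ′y = equivariant-unique ω ω≉1
    (·-equivariant ω (rotationMatrix-equivariant ω compat ωⁿ≈1) x)
    (equivariant-scale ω λ′ (lift-equivariant ω ωⁿ≈1 x))
    λ u u∈U₀ → trans (sym (masked-sum inU₀ (R u) x x-off))
      (trans (eig u (cong (isZeroComp H) u∈U₀)) (*-congˡ (sym (lift-on-U₀ ω x-off u∈U₀))))
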